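{- Let $S$ be a numerical semigroup of genus $g(S)\ge1$. Then $S$ is reflective if and only if its set of gaps $\mathcal{H}(S)$ is maximally equidistributed, which occurs if and only if $\mathcal{H}(S)$ is equidistributed modulo $g(S)$.
   Context: A numerical semigroup is a submonoid $S$ of $(\mathbb{N}_0,+)$ with finite complement; $\mathcal{H}(S)=\mathbb{N}_0\setminus S$ and $g(S)=\#\mathcal{H}(S)$. $S$ (with $g=g(S)\ge1$) is reflective if for every integer $z$ with $0\le z\le g-1$, exactly one of $z$ and $z+g$ lies in $S$. For a finite set $A\subset\mathbb{Z}$ and $m\in\mathbb{N}$, $A$ is equidistributed modulo $m$ if for all $r_1,r_2\in\{1,\dots,m\}$ the number of elements of $A$ congruent to $r_1$ modulo $m$ equals the number congruent to $r_2$ modulo $m$. $A$ is maximally equidistributed if it is equidistributed modulo every positive divisor of $\#A$. -}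

module Defs where

open import Data.Nat using (ℕ; zero; suc; _+_; _≤_; _<_; _%_; NonZero)
open import Data.Nat.Divisibility using (_∣_)
open import Data.Nat.Properties using (_≟_)
open import Data.List using (List; length; filter)
open import Data.List.Membership.Propositional using (_∈_)
open import Data.List.Relation.Unary.Unique.Propositional using (Unique)
open import Data.Product using (Σ; _×_; _,_)
open import Data.Sum using (_⊎_)
open import Relation.Nullary using (¬_; Dec)
open import Function.Bundles using (_⇔_)
open import Relation.Binary.PropositionalEquality using (_≡_)

-- The finite complement is recorded as an
-- explicit duplicate-free list of gaps, characterised by membership.
record NumericalSemigroup : Set₁ where
  field
    _∈S_   : ℕ → Set
    dec    : (n : ℕ) → Dec (_∈S_ n)
    zero∈S : _∈S_ 0
    +-closed : ∀ {a b} → _∈S_ a → _∈S_ b → _∈S_ (a + b)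
    gaps   : List ℕ
    gaps-unique : Unique gaps
    gaps-spec : (n : ℕ) → (n ∈ gaps ⇔ (¬ (_∈S_ n)))

open NumericalSemigroup public

Gaps : NumericalSemigroup → List ℕ
Gaps S = gaps S

genus : NumericalSemigroup → ℕ
genus S = length (gaps S)

_xor_ : Set → Set → Set
P xor Q = (P × ¬ Q) ⊎ (¬ P × Q)

Reflective : NumericalSemigroup → Set
Reflective S = (z : ℕ) → z < genus S → (_∈S_ S z) xor (_∈S_ S (z + genus S))

countMod : (m : ℕ) → .{{NonZero m}} → ℕ → List ℕ → ℕ
countMod m r A = length (filter (λ x → x % m ≟ r % m) A)

Equidistributed : (m : ℕ) → .{{NonZero m}} → List ℕ → Set
Equidistributed m A =
  (r₁ r₂ : ℕ) → 1 ≤ r₁ → r₁ ≤ m → 1 ≤ r₂ → r₂ ≤ m →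
  countMod m r₁ A ≡ countMod m r₂ A

MaximallyEquidistributed : List ℕ → Set
MaximallyEquidistributed A =
  (d : ℕ) → .{{_ : NonZero d}} → d ∣ length A → Equidistributed d A

-- Every gap F is below 2g: for i ≤ F, i and F − i cannot both lie in S, so
-- pairing i with F − i gives F + 1 ≤ 2·#(gaps ≤ F) ≤ 2g.  Hence H(S) ⊆ [0, 2g),
-- and for m ∣ g the number of gaps ≡ r (mod m) is the sum of p(z) over z < g with
-- z ≡ r (mod m), where p(z) is the number of gaps among z and z + g.  Reflectivity
-- says p(z) = 1 for all z < g, which makes every such count g/m.  Conversely,
-- equidistribution modulo g says p is constant on [0, g), and since its total
-- is g the constant is 1.
module Submission where

open import Defs
open import Data.Nat using (ℕ; zero; suc; _+_; _*_; _∸_; _≤_; _<_; _%_; NonZero; >-nonZero; z≤n; s≤s; s≤s⁻¹; _<?_)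
open import Data.Nat.Properties
open import Algebra.Properties.CommutativeSemigroup +-commutativeSemigroup using (interchange)
open import Data.Nat.DivMod using ([m+kn]%n≡m%n; m<n⇒m%n≡m; m%n<n; n%n≡0)
open import Data.Nat.Divisibility using (_∣_; divides; ∣-refl)
open import Data.Bool using (true; false)
open import Data.List using (List; []; _∷_; length; filter)
open import Data.List.Properties using (length-filter)
open import Data.List.Membership.Propositional using (_∈_)
open import Data.List.Membership.Propositional.Properties using (∈-filter⁺; ∈-filter⁻)
open import Data.List.Membership.DecPropositional _≟_ using (_∈?_)
open import Data.List.Relation.Unary.All as All using (All)
open import Data.List.Relation.Unary.All.Properties using (all-filter) renaming (filter⁺ to all-filter⁺)
import Data.List.Relation.Unary.Any as Any
open import Data.List.Relation.Unary.AllPairs using (_∷_)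
open import Data.List.Relation.Unary.Unique.Propositional using (Unique)
import Data.List.Relation.Unary.Unique.Propositional.Properties as Unique
open import Data.Product using (_×_; _,_; proj₁; uncurry)
open import Data.Sum using (inj₁; inj₂)
open import Data.Empty using (⊥-elim)
open import Function.Base using (_∘_)
open import Function.Bundles using (_⇔_; mk⇔; Equivalence)
open import Relation.Nullary using (¬_; Dec; _because_; yes; no; ¬?; _×-dec_; _⊎-dec_)
open import Relation.Unary using (Pred; Decidable)
open import Relation.Binary.PropositionalEquality

∑< : ℕ → (ℕ → ℕ) → ℕ
∑< zero    f = 0
∑< (suc n) f = ∑< n f + f n

∑<-cong : ∀ n {f h} → (∀ {i} → i < n → f i ≡ h i) → ∑< n f ≡ ∑< n h
∑<-cong zero    eq = refl
∑<-cong (suc n) eq = cong₂ _+_ (∑<-cong n (λ i<n → eq (m<n⇒m<1+n i<n))) (eq ≤-refl)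

∑<-mono-≤ : ∀ n {f h} → (∀ {i} → i < n → f i ≤ h i) → ∑< n f ≤ ∑< n h
∑<-mono-≤ zero    le = z≤n
∑<-mono-≤ (suc n) le = +-mono-≤ (∑<-mono-≤ n (λ i<n → le (m<n⇒m<1+n i<n))) (le ≤-refl)

∑<-distrib-+ : ∀ n f h → ∑< n (λ i → f i + h i) ≡ ∑< n f + ∑< n h
∑<-distrib-+ zero    f h = refl
∑<-distrib-+ (suc n) f h = begin
  ∑< n (λ i → f i + h i) + (f n + h n)  ≡⟨ cong (_+ (f n + h n)) (∑<-distrib-+ n f h) ⟩
  (∑< n f + ∑< n h) + (f n + h n)       ≡⟨ interchange (∑< n f) (∑< n h) (f n) (h n) ⟩
  (∑< n f + f n) + (∑< n h + h n)       ∎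
  where open ≡-Reasoning

∑<-split : ∀ m n f → ∑< (m + n) f ≡ ∑< n f + ∑< m (λ i → f (i + n))
∑<-split zero    n f = sym (+-identityʳ (∑< n f))
∑<-split (suc m) n f = begin
  ∑< (m + n) f + f (m + n)                        ≡⟨ cong (_+ f (m + n)) (∑<-split m n f) ⟩
  (∑< n f + ∑< m (λ i → f (i + n))) + f (m + n)   ≡⟨ +-assoc (∑< n f) _ (f (m + n)) ⟩
  ∑< n f + (∑< m (λ i → f (i + n)) + f (m + n))   ∎
  where open ≡-Reasoning

∑<-const : ∀ n c → ∑< n (λ _ → c) ≡ n * c
∑<-const zero    c = refl
∑<-const (suc n) c = trans (cong (_+ c) (∑<-const n c)) (+-comm (n * c) c)

∑<-suc : ∀ n f → ∑< (suc n) f ≡ f 0 + ∑< n (λ i → f (suc i))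
∑<-suc zero    f = +-comm 0 (f 0)
∑<-suc (suc n) f = begin
  ∑< (suc n) f + f (suc n)                    ≡⟨ cong (_+ f (suc n)) (∑<-suc n f) ⟩
  (f 0 + ∑< n (λ i → f (suc i))) + f (suc n)  ≡⟨ +-assoc (f 0) _ (f (suc n)) ⟩
  f 0 + (∑< n (λ i → f (suc i)) + f (suc n))  ∎
  where open ≡-Reasoning

∑<-reverse : ∀ n f → ∑< n f ≡ ∑< n (λ i → f (n ∸ suc i))
∑<-reverse zero    f = refl
∑<-reverse (suc n) f = begin
  ∑< n f + f n                                ≡⟨ cong (_+ f n) (∑<-reverse n f) ⟩
  ∑< n (λ i → f (n ∸ suc i)) + f n            ≡⟨ +-comm _ (f n) ⟩
  f n + ∑< n (λ i → f (n ∸ suc i))            ≡⟨ ∑<-suc n (λ i → f (n ∸ i)) ⟨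
  ∑< (suc n) (λ i → f (n ∸ i))                ∎
  where open ≡-Reasoning

∑<-zero : ∀ n {f} → (∀ {i} → i < n → f i ≡ 0) → ∑< n f ≡ 0
∑<-zero n eq = trans (∑<-cong n eq) (trans (∑<-const n 0) (*-zeroʳ n))

𝟙 : {P : Set} → Dec P → ℕ
𝟙 (true  because _) = 1
𝟙 (false because _) = 0

𝟙-yes : {P : Set} (P? : Dec P) → P → 𝟙 P? ≡ 1
𝟙-yes (yes _)  _ = refl
𝟙-yes (no ¬p)  p = ⊥-elim (¬p p)

𝟙-no : {P : Set} (P? : Dec P) → ¬ P → 𝟙 P? ≡ 0
𝟙-no (yes p) ¬p = ⊥-elim (¬p p)
𝟙-no (no _)  _  = refl

𝟙-cong : {P Q : Set} → P ⇔ Q → (P? : Dec P) (Q? : Dec Q) → 𝟙 P? ≡ 𝟙 Q?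
𝟙-cong P⇔Q (yes p) Q? = sym (𝟙-yes Q? (Equivalence.to P⇔Q p))
𝟙-cong P⇔Q (no ¬p) Q? = sym (𝟙-no Q? (λ q → ¬p (Equivalence.from P⇔Q q)))

𝟙-× : {P Q : Set} (P? : Dec P) (Q? : Dec Q) → 𝟙 (P? ×-dec Q?) ≡ 𝟙 P? * 𝟙 Q?
𝟙-× (yes _) (yes _) = refl
𝟙-× (yes _) (no _)  = refl
𝟙-× (no _)  _       = refl

𝟙-⊎ : {P Q : Set} (P? : Dec P) (Q? : Dec Q) → ¬ (P × Q) → 𝟙 (P? ⊎-dec Q?) ≡ 𝟙 P? + 𝟙 Q?
𝟙-⊎ (yes p) (yes q) ¬p×q = ⊥-elim (¬p×q (p , q))
𝟙-⊎ (yes _) (no _)  _    = refl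
𝟙-⊎ (no _)  (yes _) _    = refl
𝟙-⊎ (no _)  (no _)  _    = refl

𝟙-¬-either : {P Q : Set} (P? : Dec P) (Q? : Dec Q) → ¬ (P × Q) → 1 ≤ 𝟙 (¬? P?) + 𝟙 (¬? Q?)
𝟙-¬-either (yes p) (yes q) ¬p×q = ⊥-elim (¬p×q (p , q))
𝟙-¬-either (yes _) (no _)  _    = ≤-refl
𝟙-¬-either (no _)  _       _    = s≤s z≤n

xor⇔𝟙-¬+𝟙-¬≡1 : {P Q : Set} (P? : Dec P) (Q? : Dec Q) → (P xor Q) ⇔ (𝟙 (¬? P?) + 𝟙 (¬? Q?) ≡ 1)
xor⇔𝟙-¬+𝟙-¬≡1 (yes p) (yes q) = mk⇔ (λ { (inj₁ (_ , ¬q)) → ⊥-elim (¬q q) ; (inj₂ (¬p , _)) → ⊥-elim (¬p p) }) (λ ())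
xor⇔𝟙-¬+𝟙-¬≡1 (yes p) (no ¬q) = mk⇔ (λ _ → refl) (λ _ → inj₁ (p , ¬q))
xor⇔𝟙-¬+𝟙-¬≡1 (no ¬p) (yes q) = mk⇔ (λ _ → refl) (λ _ → inj₂ (¬p , q))
xor⇔𝟙-¬+𝟙-¬≡1 (no ¬p) (no ¬q) = mk⇔ (λ { (inj₁ (p , _)) → ⊥-elim (¬p p) ; (inj₂ (_ , q)) → ⊥-elim (¬q q) }) (λ ())

∑<-δ : ∀ {n z} (f : ℕ → ℕ) → z < n → ∑< n (λ i → f i * 𝟙 (i ≟ z)) ≡ f z
∑<-δ {suc n} {z} f z<1+n with m≤n⇒m<n∨m≡n (s≤s⁻¹ z<1+n)
... | inj₁ z<n = begin
  ∑< n (λ i → f i * 𝟙 (i ≟ z)) + f n * 𝟙 (n ≟ z)  ≡⟨ cong₂ _+_ (∑<-δ f z<n) (cong (f n *_) (𝟙-no (n ≟ z) (>⇒≢ z<n))) ⟩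
  f z + f n * 0                                    ≡⟨ cong (f z +_) (*-zeroʳ (f n)) ⟩
  f z + 0                                          ≡⟨ +-identityʳ (f z) ⟩
  f z                                              ∎
  where open ≡-Reasoning
... | inj₂ refl = begin
  ∑< z (λ i → f i * 𝟙 (i ≟ z)) + f z * 𝟙 (z ≟ z)  ≡⟨ cong₂ _+_ (∑<-zero z off-diagonal) (cong (f z *_) (𝟙-yes (z ≟ z) refl)) ⟩
  0 + f z * 1                                      ≡⟨ *-identityʳ (f z) ⟩
  f z                                              ∎
  where
  open ≡-Reasoning
  off-diagonal : ∀ {i} → i < z → f i * 𝟙 (i ≟ z) ≡ 0
  off-diagonal {i} i<z = trans (cong (f i *_) (𝟙-no (i ≟ z) (<⇒≢ i<z))) (*-zeroʳ (f i))

∑<-residue : ∀ {m s} .{{_ : NonZero m}} → s < m → ∀ q → ∑< (q * m) (λ i → 𝟙 (i % m ≟ s)) ≡ q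
∑<-residue         s<m zero    = refl
∑<-residue {m} {s} s<m (suc q) = begin
  ∑< (m + q * m) r                            ≡⟨ ∑<-split m (q * m) r ⟩
  ∑< (q * m) r + ∑< m (λ i → r (i + q * m))   ≡⟨ cong₂ _+_ (∑<-residue s<m q) (∑<-cong m one-period) ⟩
  q + ∑< m (λ i → 1 * 𝟙 (i ≟ s))              ≡⟨ cong (q +_) (∑<-δ (λ _ → 1) s<m) ⟩
  q + 1                                       ≡⟨ +-comm q 1 ⟩
  suc q                                       ∎
  where
  open ≡-Reasoning
  r : ℕ → ℕ
  r i = 𝟙 (i % m ≟ s)
  one-period : ∀ {i} → i < m → r (i + q * m) ≡ 1 * 𝟙 (i ≟ s)
  one-period {i} i<m = begin
    𝟙 ((i + q * m) % m ≟ s)  ≡⟨ cong (λ k → 𝟙 (k ≟ s)) (trans ([m+kn]%n≡m%n i q m) (m<n⇒m%n≡m i<m)) ⟩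
    𝟙 (i ≟ s)                ≡⟨ *-identityˡ _ ⟨
    1 * 𝟙 (i ≟ s)            ∎

length≡∑<-∈ : ∀ {xs N} → Unique xs → All (_< N) xs → length xs ≡ ∑< N (λ n → 𝟙 (n ∈? xs))
length≡∑<-∈ {[]}     {N} _                  _                  = sym (∑<-zero N (λ _ → refl))
length≡∑<-∈ {x ∷ xs} {N} (x∉xs ∷ unique) (x<N All.∷ bounded) = begin
  suc (length xs)                                           ≡⟨ cong suc (length≡∑<-∈ unique bounded) ⟩
  1 + ∑< N (λ n → 𝟙 (n ∈? xs))                              ≡⟨ cong (_+ _) (∑<-δ (λ _ → 1) x<N) ⟨
  ∑< N (λ n → 1 * 𝟙 (n ≟ x)) + ∑< N (λ n → 𝟙 (n ∈? xs))    ≡⟨ ∑<-distrib-+ N _ _ ⟨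
  ∑< N (λ n → 1 * 𝟙 (n ≟ x) + 𝟙 (n ∈? xs))                 ≡⟨ ∑<-cong N (λ {n} _ → cong (_+ 𝟙 (n ∈? xs)) (*-identityˡ (𝟙 (n ≟ x)))) ⟩
  ∑< N (λ n → 𝟙 (n ≟ x) + 𝟙 (n ∈? xs))                     ≡⟨ ∑<-cong N (λ {n} _ → 𝟙-⊎ (n ≟ x) (n ∈? xs) disjoint) ⟨
  ∑< N (λ n → 𝟙 (n ≟ x ⊎-dec n ∈? xs))                      ≡⟨ ∑<-cong N (λ {n} _ → 𝟙-cong (mk⇔ Any.fromSum Any.toSum) _ (n ∈? x ∷ xs)) ⟩
  ∑< N (λ n → 𝟙 (n ∈? x ∷ xs))                              ∎
  where
  open ≡-Reasoning
  disjoint : ∀ {n} → ¬ (n ≡ x × n ∈ xs)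
  disjoint (refl , x∈xs) = All.lookup x∉xs x∈xs refl

length-filter≡∑< : ∀ {P : Pred ℕ _} (P? : Decidable P) {xs N} → Unique xs → All (_< N) xs →
                   length (filter P? xs) ≡ ∑< N (λ n → 𝟙 (n ∈? xs) * 𝟙 (P? n))
length-filter≡∑< {P} P? {xs} {N} unique bounded = begin
  length (filter P? xs)                      ≡⟨ length≡∑<-∈ (Unique.filter⁺ P? unique) (all-filter⁺ P? bounded) ⟩
  ∑< N (λ n → 𝟙 (n ∈? filter P? xs))         ≡⟨ ∑<-cong N (λ {n} _ → 𝟙-cong ∈-filter⇔ (n ∈? filter P? xs) (n ∈? xs ×-dec P? n)) ⟩
  ∑< N (λ n → 𝟙 (n ∈? xs ×-dec P? n))        ≡⟨ ∑<-cong N (λ {n} _ → 𝟙-× (n ∈? xs) (P? n)) ⟩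
  ∑< N (λ n → 𝟙 (n ∈? xs) * 𝟙 (P? n))        ∎
  where
  open ≡-Reasoning
  ∈-filter⇔ : ∀ {n} → n ∈ filter P? xs ⇔ (n ∈ xs × P n)
  ∈-filter⇔ = mk⇔ (∈-filter⁻ P?) (uncurry (∈-filter⁺ P?))

∑<-∈≤length : ∀ {xs} N → Unique xs → ∑< N (λ n → 𝟙 (n ∈? xs)) ≤ length xs
∑<-∈≤length {xs} N unique = begin
  ∑< N (λ n → 𝟙 (n ∈? xs))              ≡⟨ ∑<-cong N (λ {n} n<N → 𝟙-cong (∈-below⇔ n<N) (n ∈? xs) (n ∈? below)) ⟩
  ∑< N (λ n → 𝟙 (n ∈? below))           ≡⟨ length≡∑<-∈ (Unique.filter⁺ (_<? N) unique) (all-filter (_<? N) xs) ⟨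
  length below                          ≤⟨ length-filter (_<? N) xs ⟩
  length xs                             ∎
  where
  open ≤-Reasoning
  below : List ℕ
  below = filter (_<? N) xs
  ∈-below⇔ : ∀ {n} → n < N → n ∈ xs ⇔ n ∈ below
  ∈-below⇔ n<N = mk⇔ (λ n∈xs → ∈-filter⁺ (_<? N) n∈xs n<N) (proj₁ ∘ ∈-filter⁻ (_<? N))

module _ (S : NumericalSemigroup) where

  private
    g : ℕ
    g = genus S

  gap : ℕ → ℕ
  gap n = 𝟙 (n ∈? gaps S)

  gap≡𝟙-∉S : ∀ n → gap n ≡ 𝟙 (¬? (dec S n))
  gap≡𝟙-∉S n = 𝟙-cong (gaps-spec S n) (n ∈? gaps S) (¬? (dec S n))

  gap-either : ∀ {i F} → i ≤ F → ¬ _∈S_ S F → 1 ≤ gap i + gap (F ∸ i)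
  gap-either {i} {F} i≤F F∉S rewrite gap≡𝟙-∉S i | gap≡𝟙-∉S (F ∸ i) =
    𝟙-¬-either (dec S i) (dec S (F ∸ i))
      (λ (i∈S , F∸i∈S) → F∉S (subst (_∈S_ S) (m+[n∸m]≡n i≤F) (+-closed S i∈S F∸i∈S)))

  gap<2g : ∀ {F} → F ∈ gaps S → F < g + g
  gap<2g {F} F∈gaps = begin
    suc F                                            ≡⟨ *-identityʳ (suc F) ⟨
    suc F * 1                                        ≡⟨ ∑<-const (suc F) 1 ⟨
    ∑< (suc F) (λ _ → 1)                             ≤⟨ ∑<-mono-≤ (suc F) (λ i<1+F → gap-either (s≤s⁻¹ i<1+F) F∉S) ⟩
    ∑< (suc F) (λ i → gap i + gap (F ∸ i))           ≡⟨ ∑<-distrib-+ (suc F) gap (λ i → gap (F ∸ i)) ⟩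
    ∑< (suc F) gap + ∑< (suc F) (λ i → gap (F ∸ i))  ≡⟨ cong (∑< (suc F) gap +_) (∑<-reverse (suc F) gap) ⟨
    ∑< (suc F) gap + ∑< (suc F) gap                  ≤⟨ +-mono-≤ gaps≤g gaps≤g ⟩
    g + g                                            ∎
    where
    open ≤-Reasoning
    F∉S : ¬ _∈S_ S F
    F∉S = Equivalence.to (gaps-spec S F) F∈gaps
    gaps≤g : ∑< (suc F) gap ≤ g
    gaps≤g = ∑<-∈≤length (suc F) (gaps-unique S)

  gaps-bounded : All (_< g + g) (gaps S)
  gaps-bounded = All.tabulate gap<2g

  gapPair : ℕ → ℕ
  gapPair z = gap z + gap (z + g)

  reflective⇔gapPair≡1 : Reflective S ⇔ (∀ z → z < g → gapPair z ≡ 1)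
  reflective⇔gapPair≡1 = mk⇔
    (λ R z z<g → trans (gapPair≡ z) (Equivalence.to (xor⇔ z) (R z z<g)))
    (λ P z z<g → Equivalence.from (xor⇔ z) (trans (sym (gapPair≡ z)) (P z z<g)))
    where
    xor⇔ : ∀ z → (_∈S_ S z xor _∈S_ S (z + g)) ⇔ (𝟙 (¬? (dec S z)) + 𝟙 (¬? (dec S (z + g))) ≡ 1)
    xor⇔ z = xor⇔𝟙-¬+𝟙-¬≡1 (dec S z) (dec S (z + g))
    gapPair≡ : ∀ z → gapPair z ≡ 𝟙 (¬? (dec S z)) + 𝟙 (¬? (dec S (z + g)))
    gapPair≡ z = cong₂ _+_ (gap≡𝟙-∉S z) (gap≡𝟙-∉S (z + g))

  ∑<-gapPair : ∑< g gapPair ≡ g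
  ∑<-gapPair = begin
    ∑< g gapPair                           ≡⟨ ∑<-distrib-+ g gap (λ i → gap (i + g)) ⟩
    ∑< g gap + ∑< g (λ i → gap (i + g))    ≡⟨ ∑<-split g g gap ⟨
    ∑< (g + g) gap                         ≡⟨ length≡∑<-∈ (gaps-unique S) gaps-bounded ⟨
    g                                      ∎
    where open ≡-Reasoning

  countMod-gaps : ∀ {m} .{{_ : NonZero m}} r → m ∣ g →
                  countMod m r (gaps S) ≡ ∑< g (λ i → gapPair i * 𝟙 (i % m ≟ r % m))
  countMod-gaps {m} r (divides q g≡qm) = begin
    countMod m r (gaps S)                                             ≡⟨ length-filter≡∑< (λ n → n % m ≟ r % m) (gaps-unique S) gaps-bounded ⟩
    ∑< (g + g) (λ n → gap n * w n)                                    ≡⟨ ∑<-split g g (λ n → gap n * w n) ⟩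
    ∑< g (λ i → gap i * w i) + ∑< g (λ i → gap (i + g) * w (i + g))  ≡⟨ cong (∑< g (λ i → gap i * w i) +_) (∑<-cong g (λ {i} _ → cong (gap (i + g) *_) (w-periodic i))) ⟩
    ∑< g (λ i → gap i * w i) + ∑< g (λ i → gap (i + g) * w i)        ≡⟨ ∑<-distrib-+ g _ _ ⟨
    ∑< g (λ i → gap i * w i + gap (i + g) * w i)                      ≡⟨ ∑<-cong g (λ {i} _ → *-distribʳ-+ (w i) (gap i) (gap (i + g))) ⟨
    ∑< g (λ i → gapPair i * w i)                                      ∎
    where
    open ≡-Reasoning
    w : ℕ → ℕ
    w n = 𝟙 (n % m ≟ r % m)
    w-periodic : ∀ i → w (i + g) ≡ w i
    w-periodic i = cong (λ k → 𝟙 (k ≟ r % m)) (trans (cong (λ k → (i + k) % m) g≡qm) ([m+kn]%n≡m%n i q m))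

  reflective⇒maximallyEquidistributed : Reflective S → MaximallyEquidistributed (gaps S)
  reflective⇒maximallyEquidistributed R d d∣g@(divides q g≡qd) r₁ r₂ _ _ _ _ =
    trans (countMod≡q r₁) (sym (countMod≡q r₂))
    where
    countMod≡q : ∀ r → countMod d r (gaps S) ≡ q
    countMod≡q r = begin
      countMod d r (gaps S)                       ≡⟨ countMod-gaps r d∣g ⟩
      ∑< g (λ i → gapPair i * w i)                ≡⟨ ∑<-cong g (λ {i} i<g → trans (cong (_* w i) (pairs≡1 i i<g)) (*-identityˡ (w i))) ⟩
      ∑< g w                                      ≡⟨ cong (λ n → ∑< n w) g≡qd ⟩
      ∑< (q * d) w                                ≡⟨ ∑<-residue (m%n<n r d) q ⟩
      q                                           ∎
      where
      open ≡-Reasoning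
      pairs≡1 : ∀ z → z < g → gapPair z ≡ 1
      pairs≡1 = Equivalence.to reflective⇔gapPair≡1 R
      w : ℕ → ℕ
      w i = 𝟙 (i % d ≟ r % d)

  module _ (1≤g : 1 ≤ g) where

    private instance
      g≢0 : NonZero g
      g≢0 = >-nonZero 1≤g

    countMod-genus : ∀ r → countMod g r (gaps S) ≡ gapPair (r % g)
    countMod-genus r = begin
      countMod g r (gaps S)                        ≡⟨ countMod-gaps r ∣-refl ⟩
      ∑< g (λ i → gapPair i * 𝟙 (i % g ≟ r % g))   ≡⟨ ∑<-cong g (λ {i} i<g → cong (λ k → gapPair i * 𝟙 (k ≟ r % g)) (m<n⇒m%n≡m i<g)) ⟩
      ∑< g (λ i → gapPair i * 𝟙 (i ≟ r % g))       ≡⟨ ∑<-δ gapPair (m%n<n r g) ⟩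
      gapPair (r % g)                              ∎
      where open ≡-Reasoning

    equidistributed⇒reflective : Equidistributed g (gaps S) → Reflective S
    equidistributed⇒reflective E = Equivalence.from reflective⇔gapPair≡1 (λ z z<g → trans (gapPair≡c z<g) c≡1)
      where
      open ≡-Reasoning
      c : ℕ
      c = countMod g g (gaps S)
      gapPair≡c : ∀ {z} → z < g → gapPair z ≡ c
      gapPair≡c {zero}  _   = trans (cong gapPair (sym (n%n≡0 g))) (sym (countMod-genus g))
      gapPair≡c {suc z} z<g = begin
        gapPair (suc z)              ≡⟨ cong gapPair (m<n⇒m%n≡m z<g) ⟨
        gapPair (suc z % g)          ≡⟨ countMod-genus (suc z) ⟨
        countMod g (suc z) (gaps S)  ≡⟨ E (suc z) g (s≤s z≤n) (<⇒≤ z<g) 1≤g ≤-refl ⟩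
        c                            ∎
      c≡1 : c ≡ 1
      c≡1 = *-cancelˡ-≡ c 1 g (begin
        g * c             ≡⟨ ∑<-const g c ⟨
        ∑< g (λ _ → c)    ≡⟨ ∑<-cong g (λ z<g → sym (gapPair≡c z<g)) ⟩
        ∑< g gapPair      ≡⟨ ∑<-gapPair ⟩
        g                 ≡⟨ *-identityʳ g ⟨
        g * 1             ∎)

proposition2p11 : (S : NumericalSemigroup) → (1≤g : 1 ≤ genus S) →
    (Reflective S ⇔ MaximallyEquidistributed (Gaps S))
      × (MaximallyEquidistributed (Gaps S) ⇔ Equidistributed (genus S) {{>-nonZero 1≤g}} (Gaps S))
proposition2p11 S 1≤g =
  mk⇔ (reflective⇒maximallyEquidistributed S) (equidistributed⇒reflective S 1≤g ∘ modulo-genus) ,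
  mk⇔ modulo-genus (reflective⇒maximallyEquidistributed S ∘ equidistributed⇒reflective S 1≤g)
  where
  modulo-genus : MaximallyEquidistributed (Gaps S) → Equidistributed (genus S) {{>-nonZero 1≤g}} (Gaps S)
  modulo-genus M = M (genus S) {{>-nonZero 1≤g}} ∣-refl
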